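{- Under the Modified CFLS coloring $\varphi$ of $K_n$ ($n=2^{m^2}$), there are no five distinct vertices $a,b,c,d,e$ with $\varphi(ab)=\varphi(be)$, $\varphi(bc)=\varphi(ac)$, $\varphi(cd)=\varphi(bd)$, $\varphi(de)=\varphi(ce)$ and $\varphi(ae)=\varphi(ad)$.
   Context: Let $m$ be a positive integer and $n=2^{m^2}$. The vertices of $K_n$ are the binary strings $v\in\{0,1\}^{m^2}$, written as $v=(v^{(1)},\dots,v^{(m)})$ with each block $v^{(k)}\in\{0,1\}^m$. Vertices (and blocks) are linearly ordered as binary integers: $x<y$ iff at the first bit where they differ, $x$ has 0 and $y$ has 1. For $x<y$, let $i$ be the first index with $x^{(i)}\ne y^{(i)}$; for $k\in[m]$ let $i_k$ be the first position at which the bits of $x^{(k)}$ and $y^{(k)}$ differ ($i_k=0$ if $x^{(k)}=y^{(k)}$), and let $\delta_k=+1$ if $x^{(k)}\le y^{(k)}$ and $\delta_k=-1$ if $x^{(k)}>y^{(k)}$. The Modified CFLS coloring assigns to edge $xy$ the color $\varphi(xy)=((i,\{x^{(i)},y^{(i)}\}),i_1,\dots,i_m,\delta_1,\dots,\delta_m)$. -}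

module Defs where

open import Data.Bool using (Bool; true; false; not; _∧_; if_then_else_)
open import Data.Nat using (ℕ; zero; suc)
open import Data.Product using (_×_; _,_)
open import Data.Maybe using (Maybe; just; nothing; maybe)
open import Data.Vec using (Vec; []; _∷_; map; concat)
open import Relation.Nullary using (Dec; yes; no)
open import Relation.Binary.PropositionalEquality using (_≡_)
open import Data.Vec.Properties using (≡-dec)
import Data.Bool.Properties as BoolP

Block : ℕ → Set
Block m = Vec Bool m

Vertex : ℕ → Set
Vertex m = Vec (Block m) m

-- Lexicographic strict order on binary strings ("as binary integers"):
-- at the first differing bit, the smaller has 0 (false) and the larger 1 (true).
lexLtᵇ : ∀ {k} → Vec Bool k → Vec Bool k → Bool
lexLtᵇ [] [] = false
lexLtᵇ (false ∷ as) (false ∷ bs) = lexLtᵇ as bs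
lexLtᵇ (true ∷ as) (true ∷ bs) = lexLtᵇ as bs
lexLtᵇ (false ∷ as) (true ∷ bs) = true
lexLtᵇ (true ∷ as) (false ∷ bs) = false

vLtᵇ : ∀ {m} → Vertex m → Vertex m → Bool
vLtᵇ x y = lexLtᵇ (concat x) (concat y)

-- First position (1-based) where two vectors differ, with the entries there;
-- nothing if the vectors are equal.
firstDiff : ∀ {a} {A : Set a} {k} → ((u v : A) → Dec (u ≡ v)) →
            Vec A k → Vec A k → Maybe (ℕ × A × A)
firstDiff eq [] [] = nothing
firstDiff eq (u ∷ us) (v ∷ vs) with eq u v
... | no _ = just (1 , u , v)
... | yes _ with firstDiff eq us vs
...   | nothing = nothing
...   | just (j , p , q) = just (suc j , p , q)

-- i_k : first bit position where two blocks differ (0 if equal)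
bitDiffPos : ∀ {m} → Block m → Block m → ℕ
bitDiffPos x y = maybe (λ { (j , _ , _) → j }) 0 (firstDiff BoolP._≟_ x y)

-- δ_k : true encodes +1 (x^(k) ≤ y^(k)), false encodes -1 (x^(k) > y^(k))
delta : ∀ {m} → Block m → Block m → Bool
delta x y = not (lexLtᵇ y x)

-- unordered pair {u , v} of blocks, represented canonically as (min , max)
UPair : ℕ → Set
UPair m = Block m × Block m

upair : ∀ {m} → Block m → Block m → UPair m
upair u v = if lexLtᵇ v u then (v , u) else (u , v)

-- the component (i, {x^(i), y^(i)}); i = 0 and a dummy pair only when x = y
-- (never used for edges, which join distinct vertices)
firstComp : ∀ {m} → Vertex m → Vertex m → ℕ × Maybe (UPair m)
firstComp {m} x y with firstDiff (≡-dec BoolP._≟_) x y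
... | nothing = 0 , nothing
... | just (i , u , v) = i , just (upair u v)

Color : ℕ → Set
Color m = (ℕ × Maybe (UPair m)) × Vec ℕ m × Vec Bool m

zipWithV : ∀ {A B C : Set} {k} → (A → B → C) → Vec A k → Vec B k → Vec C k
zipWithV f [] [] = []
zipWithV f (a ∷ as) (b ∷ bs) = f a b ∷ zipWithV f as bs

-- colour of the ordered pair x < y
colorOrd : ∀ {m} → Vertex m → Vertex m → Color m
colorOrd x y = firstComp x y , zipWithV bitDiffPos x y , zipWithV delta x y

φ : ∀ {m} → Vertex m → Vertex m → Color m
φ x y = if vLtᵇ x y then colorOrd x y else colorOrd y x

{-# OPTIONS --safe #-}
module Submission where

-- Only the first component (i, {x⁽ⁱ⁾, y⁽ⁱ⁾}) of the colour is needed. If the edges xw and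
-- yw get the same first component, then x and y both leave w first at block i, and since
-- w⁽ⁱ⁾ is one element of the pair, x⁽ⁱ⁾ = y⁽ⁱ⁾ is the other one; so x and y first differ
-- after block i. Writing ι(xy) for that block index, the five equalities give
-- ι(ab) < ι(ea) < ι(de) < ι(cd) < ι(bc) < ι(ab).

open import Defs
open import Data.Bool using (Bool; true; false; not)
open import Data.Maybe using (just)
open import Data.Maybe.Properties using (just-injective)
open import Data.Nat using (ℕ; suc; _≤_; _<_; s≤s; z≤n)
open import Data.Nat.Properties using (<-trans; <-irrefl)
open import Data.Product using (_×_; _,_; proj₁; proj₂; ∃; ∃₂)
open import Data.Sum using (_⊎_; inj₁; inj₂)
open import Data.Vec using (Vec; []; _∷_)
open import Data.Vec.Properties using (≡-dec)
open import Function using (_∘_; _⟨_⟩_)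
open import Relation.Binary.Definitions using (DecidableEquality)
open import Relation.Nullary using (¬_; yes; no; contradiction)
open import Relation.Binary.PropositionalEquality using (_≡_; _≢_; refl; sym; trans; cong; ≢-sym; module ≡-Reasoning)
import Data.Bool.Properties as BoolP

module FirstDifference {A : Set} (_≟_ : DecidableEquality A) where

  data FirstDiffAt : ∀ {k} → Vec A k → Vec A k → ℕ → A → A → Set where
    here  : ∀ {k u v} {us vs : Vec A k} → u ≢ v → FirstDiffAt (u ∷ us) (v ∷ vs) 1 u v
    there : ∀ {k w i u v} {us vs : Vec A k} →
            FirstDiffAt us vs i u v → FirstDiffAt (w ∷ us) (w ∷ vs) (suc i) u v

  firstDiffAt-exists : ∀ {k} {x y : Vec A k} → x ≢ y → ∃₂ λ i u → ∃ λ v → FirstDiffAt x y i u v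
  firstDiffAt-exists {x = []} {[]} x≢y = contradiction refl x≢y
  firstDiffAt-exists {x = u ∷ us} {v ∷ vs} x≢y with u ≟ v
  ... | no u≢v = 1 , u , v , here u≢v
  ... | yes refl with firstDiffAt-exists (x≢y ∘ cong (u ∷_))
  ...   | i , p , q , d = suc i , p , q , there d

  firstDiff-complete : ∀ {k} {x y : Vec A k} {i u v} →
                       FirstDiffAt x y i u v → firstDiff _≟_ x y ≡ just (i , u , v)
  firstDiff-complete (here {u = u} {v} u≢v) with u ≟ v
  ... | yes u≡v = contradiction u≡v u≢v
  ... | no _ = refl
  firstDiff-complete (there {w = w} d) with w ≟ w
  ... | no w≢w = contradiction refl w≢w
  ... | yes _ rewrite firstDiff-complete d = refl

  FirstDiffAt-sym : ∀ {k} {x y : Vec A k} {i u v} → FirstDiffAt x y i u v → FirstDiffAt y x i v u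
  FirstDiffAt-sym (here u≢v) = here (≢-sym u≢v)
  FirstDiffAt-sym (there d) = there (FirstDiffAt-sym d)

  FirstDiffAt⇒≢ : ∀ {k} {x y : Vec A k} {i u v} → FirstDiffAt x y i u v → u ≢ v
  FirstDiffAt⇒≢ (here u≢v) = u≢v
  FirstDiffAt⇒≢ (there d) = FirstDiffAt⇒≢ d

  FirstDiffAt⇒1≤ : ∀ {k} {x y : Vec A k} {i u v} → FirstDiffAt x y i u v → 1 ≤ i
  FirstDiffAt⇒1≤ (here _) = s≤s z≤n
  FirstDiffAt⇒1≤ (there _) = s≤s z≤n

  FirstDiffAt-rightEntry : ∀ {k} {x y w : Vec A k} {i u s u′ s′} →
                           FirstDiffAt x w i u s → FirstDiffAt y w i u′ s′ → s ≡ s′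
  FirstDiffAt-rightEntry (here _) (here _) = refl
  FirstDiffAt-rightEntry (here _) (there ())
  FirstDiffAt-rightEntry (there ()) (here _)
  FirstDiffAt-rightEntry (there d) (there d′) = FirstDiffAt-rightEntry d d′

  sameFirstDiff⇒laterDiff : ∀ {k} {x y w : Vec A k} {i u s} →
                            FirstDiffAt x w i u s → FirstDiffAt y w i u s → x ≢ y →
                            ∃₂ λ j p → ∃ λ q → FirstDiffAt x y j p q × i < j
  sameFirstDiff⇒laterDiff (here _) (here _) x≢y
    with firstDiffAt-exists (x≢y ∘ cong (_ ∷_))
  ... | j , p , q , d = suc j , p , q , there d , s≤s (FirstDiffAt⇒1≤ d)
  sameFirstDiff⇒laterDiff (here _) (there ()) _
  sameFirstDiff⇒laterDiff (there ()) (here _) _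
  sameFirstDiff⇒laterDiff (there d) (there d′) x≢y
    with sameFirstDiff⇒laterDiff d d′ (x≢y ∘ cong (_ ∷_))
  ... | j , p , q , d″ , i<j = suc j , p , q , there d″ , s≤s i<j

lexLtᵇ-connex : ∀ {k} {u v : Vec Bool k} → u ≢ v → lexLtᵇ u v ≡ not (lexLtᵇ v u)
lexLtᵇ-connex {u = []} {[]} u≢v = contradiction refl u≢v
lexLtᵇ-connex {u = false ∷ us} {false ∷ vs} u≢v = lexLtᵇ-connex (u≢v ∘ cong (false ∷_))
lexLtᵇ-connex {u = true ∷ us} {true ∷ vs} u≢v = lexLtᵇ-connex (u≢v ∘ cong (true ∷_))
lexLtᵇ-connex {u = false ∷ us} {true ∷ vs} _ = refl
lexLtᵇ-connex {u = true ∷ us} {false ∷ vs} _ = refl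

upair-comm : ∀ {k} {u v : Block k} → u ≢ v → upair u v ≡ upair v u
upair-comm {u = u} {v} u≢v rewrite lexLtᵇ-connex u≢v with lexLtᵇ v u
... | true = refl
... | false = refl

upair-cases : ∀ {k} (u v : Block k) → upair u v ≡ (u , v) ⊎ upair u v ≡ (v , u)
upair-cases u v with lexLtᵇ v u
... | true = inj₂ refl
... | false = inj₁ refl

upair-cancelʳ : ∀ {k} {u u′ s : Block k} → u ≢ s → upair u s ≡ upair u′ s → u ≡ u′
upair-cancelʳ {u = u} {u′} {s} u≢s eq with upair-cases u s | upair-cases u′ s
... | inj₁ p | inj₁ p′ = cong proj₁ (trans (sym p) (trans eq p′))
... | inj₂ p | inj₂ p′ = cong proj₂ (trans (sym p) (trans eq p′))
... | inj₁ p | inj₂ p′ = contradiction (cong proj₁ (trans (sym p) (trans eq p′))) u≢s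
... | inj₂ p | inj₁ p′ = contradiction (cong proj₂ (trans (sym p) (trans eq p′))) u≢s

module _ {m : ℕ} where
  open FirstDifference {Block m} (≡-dec BoolP._≟_)

  firstComp-at : ∀ {x y : Vertex m} {i u v} → FirstDiffAt x y i u v → firstComp x y ≡ (i , just (upair u v))
  firstComp-at d rewrite firstDiff-complete d = refl

  firstComp-comm : (x y : Vertex m) → firstComp x y ≡ firstComp y x
  firstComp-comm x y with ≡-dec (≡-dec BoolP._≟_) x y
  ... | yes refl = refl
  ... | no x≢y with firstDiffAt-exists x≢y
  ...   | i , u , v , d = begin
    firstComp x y            ≡⟨ firstComp-at d ⟩
    (i , just (upair u v))   ≡⟨ cong (λ p → i , just p) (upair-comm (FirstDiffAt⇒≢ d)) ⟩
    (i , just (upair v u))   ≡⟨ sym (firstComp-at (FirstDiffAt-sym d)) ⟩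
    firstComp y x            ∎
    where open ≡-Reasoning

  φ-firstComp : (x y : Vertex m) → proj₁ (φ x y) ≡ firstComp x y
  φ-firstComp x y with vLtᵇ x y
  ... | true = refl
  ... | false = firstComp-comm y x

  firstDiffBlock : Vertex m → Vertex m → ℕ
  firstDiffBlock x y = proj₁ (firstComp x y)

  sameFirstComp⇒laterDiff : ∀ {x y w : Vertex m} → x ≢ w → y ≢ w → x ≢ y →
                            firstComp x w ≡ firstComp y w → firstDiffBlock y w < firstDiffBlock x y
  sameFirstComp⇒laterDiff x≢w y≢w x≢y same
    with firstDiffAt-exists x≢w | firstDiffAt-exists y≢w
  ... | i , u , s , dx | j , u′ , s′ , dy
    with trans (sym (firstComp-at dx)) (trans same (firstComp-at dy))
  ... | comps
    with refl ← cong proj₁ comps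
    with refl ← FirstDiffAt-rightEntry dx dy
    with refl ← upair-cancelʳ (FirstDiffAt⇒≢ dx) (just-injective (cong proj₂ comps))
    with sameFirstDiff⇒laterDiff dx dy x≢y
  ... | k , p , q , dxy , i<k rewrite firstComp-at dy | firstComp-at dxy = i<k

lemma12 : (m : ℕ) → 1 ≤ m → (a b c d e : Vertex m) →
          a ≢ b → a ≢ c → a ≢ d → a ≢ e → b ≢ c → b ≢ d → b ≢ e →
          c ≢ d → c ≢ e → d ≢ e →
          ¬ ((φ a b ≡ φ b e) × (φ b c ≡ φ a c) × (φ c d ≡ φ b d) ×
             (φ d e ≡ φ c e) × (φ a e ≡ φ a d))
lemma12 m _ a b c d e a≢b a≢c a≢d a≢e b≢c b≢d b≢e c≢d c≢e d≢e (ab=be , bc=ac , cd=bd , de=ce , ae=ad) =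
  <-irrefl refl (ea<de ⟨ <-trans ⟩ de<cd ⟨ <-trans ⟩ cd<bc ⟨ <-trans ⟩ bc<ab ⟨ <-trans ⟩ ab<ea)
  where
  firstComp≡ : ∀ {x y z w : Vertex m} → φ x y ≡ φ z w → firstComp x y ≡ firstComp z w
  firstComp≡ {x} {y} {z} {w} eq = trans (sym (φ-firstComp x y)) (trans (cong proj₁ eq) (φ-firstComp z w))

  ab<ea : firstDiffBlock a b < firstDiffBlock e a
  ab<ea = sameFirstComp⇒laterDiff (≢-sym b≢e) a≢b (≢-sym a≢e)
            (sym (trans (firstComp≡ ab=be) (firstComp-comm b e)))

  bc<ab : firstDiffBlock b c < firstDiffBlock a b
  bc<ab = sameFirstComp⇒laterDiff a≢c b≢c a≢b (sym (firstComp≡ bc=ac))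

  cd<bc : firstDiffBlock c d < firstDiffBlock b c
  cd<bc = sameFirstComp⇒laterDiff b≢d c≢d b≢c (sym (firstComp≡ cd=bd))

  de<cd : firstDiffBlock d e < firstDiffBlock c d
  de<cd = sameFirstComp⇒laterDiff c≢e d≢e c≢d (sym (firstComp≡ de=ce))

  ea<de : firstDiffBlock e a < firstDiffBlock d e
  ea<de = sameFirstComp⇒laterDiff (≢-sym a≢d) (≢-sym a≢e) d≢e
            (trans (firstComp-comm d a) (trans (sym (firstComp≡ ae=ad)) (firstComp-comm a e)))
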